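{- Let $G=(V,E)$ be a finite simple graph and let $C\subseteq V$ be a minimum vertex cover of $G$. Then $G$ is of class two if and only if for any two (not necessarily distinct) nonempty independent sets $S,T\subseteq C$ we have $|N_{V-C}(S)\cap N_{V-C}(T)|>|S|+|T|$.
   Context: For $X\subseteq V$, $N(X)$ is the union of neighborhoods of vertices of $X$ and $N_S(X)=N(X)\cap S$. $\beta(G)$ is the size of a minimum vertex cover. Alcuin problem: the vertices of $G$ are items initially on the left bank of a river; a man with a boat of capacity $b$ (a positive integer) must carry them all to the right bank so that no two adjacent vertices are ever left together on a bank. Formally, a feasible schedule for capacity $b$ is a sequence of triples $(L_k,B_k,R_k)$, $k=1,\dots,s$, $s$ odd, such that: each triple is a partition of $V$; $L_k$ and $R_k$ are independent sets; $|B_k|\le b$; $L_1\cup B_1=V$; $B_s\cup R_s=V$; for even $k$, $L_k=L_{k-1}$ and $B_k\cup R_k=B_{k-1}\cup R_{k-1}$; for odd $k\ge 3$, $R_k=R_{k-1}$ and $B_k\cup L_k=B_{k-1}\cup L_{k-1}$. The Alcuin number $c(G)$ is the least positive integer $b$ for which a feasible schedule exists. One always has $\beta(G)\le c(G)\le \beta(G)+1$; $G$ is of class one if $c(G)=\beta(G)$ and of class two if $c(G)=\beta(G)+1$. -}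

module Defs where

open import Data.Nat using (ℕ; suc; _+_; _*_; _≤_; _<_)
open import Data.Fin using (Fin)
open import Data.Fin.Subset using (Subset; _∈_; _∉_; _⊆_; _∩_; _∪_; ∣_∣; Nonempty)
  renaming (⊥ to ∅; ⊤ to Full)
open import Data.Fin.Subset.Properties using (_∈?_)
open import Data.Fin.Properties using (any?)
open import Data.Vec using (tabulate)
open import Data.Product using (Σ; _×_; _,_; ∃)
open import Data.Sum using (_⊎_)
open import Relation.Nullary using (¬_; Dec)
open import Relation.Nullary.Decidable using (⌊_⌋; _×-dec_; ¬?)
open import Relation.Binary.PropositionalEquality using (_≡_)

record SimpleGraph (n : ℕ) : Set₁ where
  field
    Adj    : Fin n → Fin n → Set
    adj?   : (u v : Fin n) → Dec (Adj u v)
    sym    : ∀ {u v} → Adj u v → Adj v u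
    irrefl : ∀ {u} → ¬ Adj u u
open SimpleGraph public

module _ {n : ℕ} (G : SimpleGraph n) where

  Independent : Subset n → Set
  Independent S = ∀ u v → u ∈ S → v ∈ S → ¬ Adj G u v

  IsVertexCover : Subset n → Set
  IsVertexCover C = ∀ u v → Adj G u v → u ∈ C ⊎ v ∈ C

  IsMinimumVertexCover : Subset n → Set
  IsMinimumVertexCover C = IsVertexCover C × (∀ D → IsVertexCover D → ∣ C ∣ ≤ ∣ D ∣)

  IsVertexCoverNumber : ℕ → Set
  IsVertexCoverNumber k = Σ (Subset n) λ C → IsMinimumVertexCover C × ∣ C ∣ ≡ k

  NbhdOutside : Subset n → Subset n → Subset n
  NbhdOutside C S =
    tabulate λ w → ⌊ ¬? (w ∈? C) ×-dec any? (λ v → (v ∈? S) ×-dec adj? G v w) ⌋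

  record Triple : Set where
    field
      L B R   : Subset n
      cover   : (L ∪ B) ∪ R ≡ Full
      disjLB  : L ∩ B ≡ ∅
      disjLR  : L ∩ R ≡ ∅
      disjBR  : B ∩ R ≡ ∅
  open Triple public

  -- Feasible schedule for capacity b: triples (L_k,B_k,R_k), k = 1..s, s odd,
  -- stored 0-indexed as t 0, ..., t (s-1) with s = 2m+1.
  record FeasibleSchedule (b : ℕ) : Set where
    field
      m      : ℕ
      t      : ℕ → Triple
      indepL : ∀ k → k < suc (2 * m) → Independent (L (t k))
      indepR : ∀ k → k < suc (2 * m) → Independent (R (t k))
      cap    : ∀ k → k < suc (2 * m) → ∣ B (t k) ∣ ≤ b
      start  : L (t 0) ∪ B (t 0) ≡ Full
      finish : B (t (2 * m)) ∪ R (t (2 * m)) ≡ Full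
      -- paper index k even (here index 2j+1, predecessor 2j)
      evenL  : ∀ j → suc (2 * j) < suc (2 * m) →
               L (t (suc (2 * j))) ≡ L (t (2 * j))
      evenBR : ∀ j → suc (2 * j) < suc (2 * m) →
               B (t (suc (2 * j))) ∪ R (t (suc (2 * j))) ≡ B (t (2 * j)) ∪ R (t (2 * j))
      -- paper index k odd, k ≥ 3 (here index 2j+2, predecessor 2j+1)
      oddR   : ∀ j → suc (suc (2 * j)) < suc (2 * m) →
               R (t (suc (suc (2 * j)))) ≡ R (t (suc (2 * j)))
      oddBL  : ∀ j → suc (suc (2 * j)) < suc (2 * m) →
               B (t (suc (suc (2 * j)))) ∪ L (t (suc (suc (2 * j)))) ≡ B (t (suc (2 * j))) ∪ L (t (suc (2 * j)))

  Feasible : ℕ → Set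
  Feasible b = FeasibleSchedule b

  IsAlcuinNumber : ℕ → Set
  IsAlcuinNumber c = 1 ≤ c × Feasible c × (∀ b → 1 ≤ b → Feasible b → c ≤ b)

  ClassTwo : Set
  ClassTwo = Σ ℕ λ β → IsVertexCoverNumber β × Σ ℕ λ c → IsAlcuinNumber c × c ≡ suc β

-- Write N(S) for N_{V-C}(S).  A boat of capacity |C| + 1 always suffices: keep C in the boat
-- and take the other vertices across one at a time.  If some nonempty independent S, T ⊆ C
-- have |N(S) ∩ N(T)| ≤ |S| + |T|, capacity |C| suffices too: with S resting on the right bank,
-- the vertices outside N(S) go over one per round; N(S) ∩ N(T) then crosses in two batches of
-- at most |S| and |T| vertices, the first while S still rests on the right and the second while
-- T rests on the left; finally N(S) - N(T) goes over one per round while T stays on the left.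
--
-- Conversely, let the condition hold and suppose capacity at most |C| suffices.  If X and Y are
-- the cover vertices on the left and on the right bank, the boat carries at most |X| + |Y|
-- vertices outside C, and N(X) ∩ N(Y) lies in the boat; so X and Y are never both nonempty.
-- Along the schedule, X stays empty and some nonempty independent S ⊆ C keeps N(S) inside the
-- left bank together with a set of at most |S| vertices.  When the left bank finally empties,
-- |N(S)| ≤ |S| contradicts the condition for the pair (S, S).

module Submission where

open import Defs hiding (sym)
open import Data.Nat using (ℕ; zero; suc; _+_; _*_; _≤_; _<_; z≤n; s≤s; _≤?_; _<?_; ⌊_/2⌋; ⌈_/2⌉)
open import Data.Nat.Properties
  using ( +-comm; +-suc; +-identityʳ; *-suc; +-cancelˡ-≡; +-cancelˡ-≤; +-cancelʳ-≤; +-mono-≤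
        ; +-monoˡ-≤; +-monoʳ-≤; +-monoʳ-<; ≤-refl; ≤-reflexive; ≤-trans; ≤-antisym; ≤-pred
        ; <-irrefl; <⇒≤; <⇒≱; <⇒≢; ≮⇒≥; ≰⇒>; 1+n≰n; 1+n≢n; m≢1+m+n; suc-injective; n≤1+n; m≤n⇒m≤1+n
        ; m≤m+n; n≡⌊n+n/2⌋; n≡⌈n+n/2⌉; ⌊n/2⌋-mono; ⌈n/2⌉-mono; ⌊n/2⌋≤⌈n/2⌉; module ≤-Reasoning )
open import Data.Fin using (Fin; toℕ)
open import Data.Fin.Properties using (toℕ<n; toℕ-injective)
open import Data.Fin.Subset
  using (Subset; inside; outside; _∈_; _∉_; _⊆_; _∩_; _∪_; _─_; ∁; ⁅_⁆; ∣_∣; Nonempty)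
  renaming (⊥ to ∅; ⊤ to Full)
open import Data.Fin.Subset.Properties
  using ( _∈?_; nonempty?; Empty-unique; ∈⊤; ∉⊥; ⊥⊆; ⊆⊤; ⊆-antisym; ∪-comm; ∣⊥∣≡0; ∣p∣≤∣x∷p∣
        ; ∣⁅x⁆∣≡1; x∈⁅x⁆; x∈⁅y⁆⇒x≡y; p⊆q⇒∣p∣≤∣q∣; p⊆p∪q; p─q⊆p; p─⊥≡p; x∈p∧x∉q⇒x∈p─q
        ; x∈p∩q⁺; x∈p∩q⁻; x∈p∪q⁺; x∈p∪q⁻; x∈∁p⇒x∉p; x∉p⇒x∈∁p; x∈p⇒x∉∁p )
open import Data.Vec using ([]; _∷_; here; there; tabulate)
open import Data.Vec.Properties using (lookup∘tabulate; lookup⇒[]=; []=⇒lookup)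
open import Data.Product using (_×_; _,_; proj₁; proj₂; ∃-syntax; uncurry)
open import Data.Sum using (_⊎_; inj₁; inj₂; [_,_])
open import Data.Empty using (⊥; ⊥-elim)
open import Function using (_∘_)
open import Function.Bundles using (_⇔_; mk⇔)
open import Relation.Nullary using (¬_; Dec; yes; no; contradiction)
open import Relation.Nullary.Decidable using (⌊_⌋; isYes≗does; dec-true; ¬?; _×-dec_; _⊎-dec_)
open import Relation.Unary using (Decidable)
open import Relation.Binary.PropositionalEquality
  using (_≡_; _≢_; refl; sym; trans; cong; cong₂; subst; subst₂)

module _ {n : ℕ} {P : Fin n → Set} (P? : Decidable P) where

  ∈-tabulate⁺ : ∀ {x} → P x → x ∈ tabulate (λ y → ⌊ P? y ⌋)
  ∈-tabulate⁺ {x} px =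
    lookup⇒[]= x _ (trans (lookup∘tabulate _ x) (trans (isYes≗does (P? x)) (dec-true (P? x) px)))

  ∈-tabulate⁻ : ∀ {x} → x ∈ tabulate (λ y → ⌊ P? y ⌋) → P x
  ∈-tabulate⁻ {x} x∈ with P? x | trans (sym (lookup∘tabulate (λ y → ⌊ P? y ⌋) x)) ([]=⇒lookup x∈)
  ... | yes px | _ = px
  ... | no _   | ()

x∈p─q⇒x∉q : ∀ {n} {p q : Subset n} {x} → x ∈ p ─ q → x ∉ q
x∈p─q⇒x∉q {p = _ ∷ _} {inside ∷ _} () here
x∈p─q⇒x∉q {p = _ ∷ _} {_ ∷ _} (there x∈p─q) (there x∈q) = x∈p─q⇒x∉q x∈p─q x∈q

disjoint⇒p∩q≡∅ : ∀ {n} {p q : Subset n} → (∀ {x} → x ∈ p → x ∉ q) → p ∩ q ≡ ∅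
disjoint⇒p∩q≡∅ {p = p} disjoint =
  ⊆-antisym (λ x∈p∩q → ⊥-elim (uncurry disjoint (x∈p∩q⁻ p _ x∈p∩q))) ⊥⊆

full-by-∈ : ∀ {n} {p : Subset n} → (∀ x → x ∈ p) → p ≡ Full
full-by-∈ ∈p = ⊆-antisym ⊆⊤ (λ {x} _ → ∈p x)

x∉p∪q : ∀ {n} {p q : Subset n} {x} → x ∉ p → x ∉ q → x ∉ p ∪ q
x∉p∪q {p = p} {q} x∉p x∉q = [ x∉p , x∉q ] ∘ x∈p∪q⁻ p q

∁[p∪q]∪q≡∁p : ∀ {n} {p q : Subset n} → (∀ {x} → x ∈ q → x ∉ p) → ∁ (p ∪ q) ∪ q ≡ ∁ p
∁[p∪q]∪q≡∁p {p = p} {q} q-disjoint-p = ⊆-antisym ⊆∁p ∁p⊆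
  where
  ⊆∁p : ∁ (p ∪ q) ∪ q ⊆ ∁ p
  ⊆∁p x∈ with x∈p∪q⁻ (∁ (p ∪ q)) q x∈
  ... | inj₁ x∈∁[p∪q] = x∉p⇒x∈∁p (x∈∁p⇒x∉p x∈∁[p∪q] ∘ p⊆p∪q q)
  ... | inj₂ x∈q      = x∉p⇒x∈∁p (q-disjoint-p x∈q)
  ∁p⊆ : ∁ p ⊆ ∁ (p ∪ q) ∪ q
  ∁p⊆ {x} x∈∁p with x ∈? q
  ... | yes x∈q = x∈p∪q⁺ (inj₂ x∈q)
  ... | no  x∉q = x∈p∪q⁺ (inj₁ (x∉p⇒x∈∁p (x∉p∪q (x∈∁p⇒x∉p x∈∁p) x∉q)))

-- Counting finite subsets

∣p∣+∣q─p∣≡∣q∣+∣p─q∣ : ∀ {n} (p q : Subset n) → ∣ p ∣ + ∣ q ─ p ∣ ≡ ∣ q ∣ + ∣ p ─ q ∣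
∣p∣+∣q─p∣≡∣q∣+∣p─q∣ []            []            = refl
∣p∣+∣q─p∣≡∣q∣+∣p─q∣ (inside  ∷ p) (inside  ∷ q) = cong suc (∣p∣+∣q─p∣≡∣q∣+∣p─q∣ p q)
∣p∣+∣q─p∣≡∣q∣+∣p─q∣ (outside ∷ p) (outside ∷ q) = ∣p∣+∣q─p∣≡∣q∣+∣p─q∣ p q
∣p∣+∣q─p∣≡∣q∣+∣p─q∣ (inside  ∷ p) (outside ∷ q) =
  trans (cong suc (∣p∣+∣q─p∣≡∣q∣+∣p─q∣ p q)) (sym (+-suc ∣ q ∣ ∣ p ─ q ∣))
∣p∣+∣q─p∣≡∣q∣+∣p─q∣ (outside ∷ p) (inside  ∷ q) =
  trans (+-suc ∣ p ∣ ∣ q ─ p ∣) (cong suc (∣p∣+∣q─p∣≡∣q∣+∣p─q∣ p q))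

module _ {n : ℕ} (p q : Subset n) where

  ∣p∣≤∣q∣⇒∣p─q∣≤∣q─p∣ : ∣ p ∣ ≤ ∣ q ∣ → ∣ p ─ q ∣ ≤ ∣ q ─ p ∣
  ∣p∣≤∣q∣⇒∣p─q∣≤∣q─p∣ ∣p∣≤∣q∣ = +-cancelˡ-≤ ∣ q ∣ _ _ (begin
    ∣ q ∣ + ∣ p ─ q ∣ ≡⟨ sym (∣p∣+∣q─p∣≡∣q∣+∣p─q∣ p q) ⟩
    ∣ p ∣ + ∣ q ─ p ∣ ≤⟨ +-monoˡ-≤ _ ∣p∣≤∣q∣ ⟩
    ∣ q ∣ + ∣ q ─ p ∣ ∎)
    where open ≤-Reasoning

  ∣p─q∣≤∣q─p∣⇒∣p∣≤∣q∣ : ∣ p ─ q ∣ ≤ ∣ q ─ p ∣ → ∣ p ∣ ≤ ∣ q ∣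
  ∣p─q∣≤∣q─p∣⇒∣p∣≤∣q∣ ∣p─q∣≤∣q─p∣ = +-cancelʳ-≤ ∣ q ─ p ∣ _ _ (begin
    ∣ p ∣ + ∣ q ─ p ∣ ≡⟨ ∣p∣+∣q─p∣≡∣q∣+∣p─q∣ p q ⟩
    ∣ q ∣ + ∣ p ─ q ∣ ≤⟨ +-monoʳ-≤ ∣ q ∣ ∣p─q∣≤∣q─p∣ ⟩
    ∣ q ∣ + ∣ q ─ p ∣ ∎)
    where open ≤-Reasoning

  ∣p∣≤∣q∣+∣p─q∣ : ∣ p ∣ ≤ ∣ q ∣ + ∣ p ─ q ∣
  ∣p∣≤∣q∣+∣p─q∣ = begin
    ∣ p ∣             ≤⟨ m≤m+n ∣ p ∣ ∣ q ─ p ∣ ⟩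
    ∣ p ∣ + ∣ q ─ p ∣ ≡⟨ ∣p∣+∣q─p∣≡∣q∣+∣p─q∣ p q ⟩
    ∣ q ∣ + ∣ p ─ q ∣ ∎
    where open ≤-Reasoning

∣p∪q∣≤∣p∣+∣q∣ : ∀ {n} (p q : Subset n) → ∣ p ∪ q ∣ ≤ ∣ p ∣ + ∣ q ∣
∣p∪q∣≤∣p∣+∣q∣ []            []            = z≤n
∣p∪q∣≤∣p∣+∣q∣ (outside ∷ p) (outside ∷ q) = ∣p∪q∣≤∣p∣+∣q∣ p q
∣p∪q∣≤∣p∣+∣q∣ (inside  ∷ p) (y       ∷ q) =
  s≤s (≤-trans (∣p∪q∣≤∣p∣+∣q∣ p q) (+-monoʳ-≤ ∣ p ∣ (∣p∣≤∣x∷p∣ y q)))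
∣p∪q∣≤∣p∣+∣q∣ (outside ∷ p) (inside  ∷ q) =
  ≤-trans (s≤s (∣p∪q∣≤∣p∣+∣q∣ p q)) (≤-reflexive (sym (+-suc ∣ p ∣ ∣ q ∣)))

x∈p⇒1≤∣p∣ : ∀ {n} {p : Subset n} {x} → x ∈ p → 1 ≤ ∣ p ∣
x∈p⇒1≤∣p∣ {p = p} {x} x∈p = subst (_≤ ∣ p ∣) (∣⁅x⁆∣≡1 x) (p⊆q⇒∣p∣≤∣q∣ ⁅x⁆⊆p)
  where
  ⁅x⁆⊆p : ⁅ x ⁆ ⊆ p
  ⁅x⁆⊆p y∈⁅x⁆ = subst (_∈ p) (sym (x∈⁅y⁆⇒x≡y x y∈⁅x⁆)) x∈p

empty⇒∣p∣≡0 : ∀ {n} {p : Subset n} → ¬ Nonempty p → ∣ p ∣ ≡ 0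
empty⇒∣p∣≡0 {n} empty = trans (cong ∣_∣ (Empty-unique empty)) (∣⊥∣≡0 n)

1≤∣p∣⇒nonempty : ∀ {n} {p : Subset n} → 1 ≤ ∣ p ∣ → Nonempty p
1≤∣p∣⇒nonempty {p = p} 1≤∣p∣ with nonempty? p
... | yes p≠∅  = p≠∅
... | no  empty = contradiction (subst (1 ≤_) (empty⇒∣p∣≡0 empty) 1≤∣p∣) λ ()

subsingleton⇒∣p∣≤1 : ∀ {n} (p : Subset n) → (∀ {x y} → x ∈ p → y ∈ p → x ≡ y) → ∣ p ∣ ≤ 1
subsingleton⇒∣p∣≤1 p unique with nonempty? p
... | no  empty = ≤-trans (≤-reflexive (empty⇒∣p∣≡0 empty)) z≤n
... | yes (x , x∈p) = subst (∣ p ∣ ≤_) (∣⁅x⁆∣≡1 x) (p⊆q⇒∣p∣≤∣q∣ p⊆⁅x⁆)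
  where
  p⊆⁅x⁆ : p ⊆ ⁅ x ⁆
  p⊆⁅x⁆ y∈p = subst (_∈ ⁅ x ⁆) (unique x∈p y∈p) (x∈⁅x⁆ x)

∣p∣≤s+t⇒split : ∀ {n} (p : Subset n) s t → ∣ p ∣ ≤ s + t → ∃[ q ] ∣ q ∣ ≤ s × ∣ p ─ q ∣ ≤ t
∣p∣≤s+t⇒split []            s       t _ = [] , z≤n , z≤n
∣p∣≤s+t⇒split (outside ∷ p) s       t ∣p∣≤ with ∣p∣≤s+t⇒split p s t ∣p∣≤
... | q , ∣q∣≤s , ∣p─q∣≤t = outside ∷ q , ∣q∣≤s , ∣p─q∣≤t
∣p∣≤s+t⇒split (inside  ∷ p) (suc s) t (s≤s ∣p∣≤) with ∣p∣≤s+t⇒split p s t ∣p∣≤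
... | q , ∣q∣≤s , ∣p─q∣≤t = inside ∷ q , s≤s ∣q∣≤s , ∣p─q∣≤t
∣p∣≤s+t⇒split {suc n} p@(inside ∷ _) zero t ∣p∣≤t =
  ∅ , ≤-reflexive (∣⊥∣≡0 (suc n)) , subst (λ r → ∣ r ∣ ≤ t) (sym (p─⊥≡p p)) ∣p∣≤t

⌊2n/2⌋≡n : ∀ n → ⌊ 2 * n /2⌋ ≡ n
⌊2n/2⌋≡n n = sym (trans (n≡⌊n+n/2⌋ n) (cong (λ m → ⌊ n + m /2⌋) (sym (+-identityʳ n))))

⌈2n/2⌉≡n : ∀ n → ⌈ 2 * n /2⌉ ≡ n
⌈2n/2⌉≡n n = sym (trans (n≡⌈n+n/2⌉ n) (cong (λ m → ⌈ n + m /2⌉) (sym (+-identityʳ n))))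

⌈n/2⌉≤1+⌊n/2⌋ : ∀ n → ⌈ n /2⌉ ≤ suc ⌊ n /2⌋
⌈n/2⌉≤1+⌊n/2⌋ zero          = z≤n
⌈n/2⌉≤1+⌊n/2⌋ (suc zero)    = s≤s z≤n
⌈n/2⌉≤1+⌊n/2⌋ (suc (suc n)) = s≤s (⌈n/2⌉≤1+⌊n/2⌋ n)

data Parity : ℕ → Set where
  even : ∀ j → Parity (2 * j)
  odd  : ∀ j → Parity (suc (2 * j))

parity : ∀ k → Parity k
parity zero = even 0
parity (suc k) with parity k
... | even j = odd j
... | odd  j = subst Parity (*-suc 2 j) (even (suc j))

module _ {n : ℕ} (G : SimpleGraph n) where

  module _ (C : Subset n) where

    ∈NbhdOutside⁺ : ∀ {S v w} → w ∉ C → v ∈ S → Adj G v w → w ∈ NbhdOutside G C S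
    ∈NbhdOutside⁺ w∉C v∈S v~w = ∈-tabulate⁺ _ (w∉C , _ , v∈S , v~w)

    ∈NbhdOutside⁻ : ∀ {S w} → w ∈ NbhdOutside G C S → w ∉ C × ∃[ v ] v ∈ S × Adj G v w
    ∈NbhdOutside⁻ = ∈-tabulate⁻ _

    Expansion : Set
    Expansion = (S T : Subset n) → Nonempty S → Nonempty T → Independent G S → Independent G T →
                S ⊆ C → T ⊆ C → ∣ S ∣ + ∣ T ∣ < ∣ NbhdOutside G C S ∩ NbhdOutside G C T ∣

  -- Schedules given round by round

  partition : (L R : Subset n) → (∀ {v} → v ∈ L → v ∉ R) → Triple G
  partition L R disjoint = record
    { L      = L
    ; B      = ∁ (L ∪ R)
    ; R      = R
    ; cover  = full-by-∈ covered
    ; disjLB = disjoint⇒p∩q≡∅ λ x∈L → x∈p⇒x∉∁p (x∈p∪q⁺ (inj₁ x∈L))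
    ; disjLR = disjoint⇒p∩q≡∅ disjoint
    ; disjBR = disjoint⇒p∩q≡∅ λ x∈B x∈R → x∈p⇒x∉∁p (x∈p∪q⁺ (inj₂ x∈R)) x∈B
    }
    where
    covered : ∀ x → x ∈ (L ∪ ∁ (L ∪ R)) ∪ R
    covered x with x ∈? L | x ∈? R
    ... | yes x∈L | _       = x∈p∪q⁺ (inj₁ (x∈p∪q⁺ (inj₁ x∈L)))
    ... | no  _   | yes x∈R = x∈p∪q⁺ (inj₂ x∈R)
    ... | no  x∉L | no  x∉R = x∈p∪q⁺ (inj₁ (x∈p∪q⁺ (inj₂ (x∉p⇒x∈∁p (x∉p∪q x∉L x∉R)))))

  -- Round j consists of the forward trip 2j and the return trip 2j+1.  During trip k the banks
  -- are left ⌊k/2⌋ and right ⌈k/2⌉, so a bank changes only while the man is on it.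
  record Shuttle (b : ℕ) : Set where
    field
      rounds            : ℕ
      left right        : ℕ → Subset n
      disjoint          : ∀ {j i} → j ≤ i → i ≤ suc j → ∀ {v} → v ∈ left j → v ∉ right i
      left-independent  : ∀ {j} → j ≤ rounds → Independent G (left j)
      right-independent : ∀ {i} → i ≤ rounds → Independent G (right i)
      capacity          : ∀ {j i} → j ≤ i → i ≤ suc j → i ≤ rounds → ∣ ∁ (left j ∪ right i) ∣ ≤ b
      starts-left       : ∀ {v} → v ∉ right 0
      ends-right        : ∀ {v} → v ∉ left rounds

  shuttle⇒feasible : ∀ {b} → Shuttle b → Feasible G b
  shuttle⇒feasible shuttle = record
    { m      = rounds
    ; t      = trip
    ; indepL = λ k k≤2m → left-independent (⌊k/2⌋≤rounds k≤2m)
    ; indepR = λ k k≤2m → right-independent (⌈k/2⌉≤rounds k≤2m)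
    ; cap    = λ k k≤2m → capacity (⌊n/2⌋≤⌈n/2⌉ k) (⌈n/2⌉≤1+⌊n/2⌋ k) (⌈k/2⌉≤rounds k≤2m)
    ; start  = full-by-∈ λ v → ∈-left-or-boat (starts-left {v})
    ; finish = trans (boat∪right≡∁left (2 * rounds)) (full-by-∈ λ v → x∉p⇒x∈∁p (ends-right′ {v}))
    ; evenL  = λ j _ → left≡ j
    ; evenBR = λ j _ → trans (boat∪right≡∁left (suc (2 * j)))
                         (trans (cong ∁ (left≡ j)) (sym (boat∪right≡∁left (2 * j))))
    ; oddR   = λ j _ → right≡ j
    ; oddBL  = λ j _ → trans (boat∪left≡∁right (suc (suc (2 * j))))
                         (trans (cong ∁ (right≡ j)) (sym (boat∪left≡∁right (suc (2 * j)))))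
    }
    where
    open Shuttle shuttle

    disjoint-during : ∀ k {v} → v ∈ left ⌊ k /2⌋ → v ∉ right ⌈ k /2⌉
    disjoint-during k = disjoint (⌊n/2⌋≤⌈n/2⌉ k) (⌈n/2⌉≤1+⌊n/2⌋ k)

    trip : ℕ → Triple G
    trip k = partition (left ⌊ k /2⌋) (right ⌈ k /2⌉) (disjoint-during k)

    ⌊k/2⌋≤rounds : ∀ {k} → k < suc (2 * rounds) → ⌊ k /2⌋ ≤ rounds
    ⌊k/2⌋≤rounds k≤2m = ≤-trans (⌊n/2⌋-mono (≤-pred k≤2m)) (≤-reflexive (⌊2n/2⌋≡n rounds))

    ⌈k/2⌉≤rounds : ∀ {k} → k < suc (2 * rounds) → ⌈ k /2⌉ ≤ rounds
    ⌈k/2⌉≤rounds k≤2m = ≤-trans (⌈n/2⌉-mono (≤-pred k≤2m)) (≤-reflexive (⌈2n/2⌉≡n rounds))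

    left≡ : ∀ j → left ⌊ suc (2 * j) /2⌋ ≡ left ⌊ 2 * j /2⌋
    left≡ j = cong left (trans (⌈2n/2⌉≡n j) (sym (⌊2n/2⌋≡n j)))

    right≡ : ∀ j → right ⌈ suc (suc (2 * j)) /2⌉ ≡ right ⌈ suc (2 * j) /2⌉
    right≡ j = cong (right ∘ suc) (trans (⌈2n/2⌉≡n j) (sym (⌊2n/2⌋≡n j)))

    boat∪right≡∁left : ∀ k → B (trip k) ∪ R (trip k) ≡ ∁ (L (trip k))
    boat∪right≡∁left k = ∁[p∪q]∪q≡∁p (λ x∈R x∈L → disjoint-during k x∈L x∈R)

    boat∪left≡∁right : ∀ k → B (trip k) ∪ L (trip k) ≡ ∁ (R (trip k))
    boat∪left≡∁right k =
      trans (cong (λ p → ∁ p ∪ L (trip k)) (∪-comm (L (trip k)) (R (trip k))))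
            (∁[p∪q]∪q≡∁p (disjoint-during k))

    ∈-left-or-boat : ∀ {v} → v ∉ right 0 → v ∈ left 0 ∪ ∁ (left 0 ∪ right 0)
    ∈-left-or-boat {v} v∉R with v ∈? left 0
    ... | yes v∈L = x∈p∪q⁺ (inj₁ v∈L)
    ... | no  v∉L = x∈p∪q⁺ (inj₂ (x∉p⇒x∈∁p (x∉p∪q v∉L v∉R)))

    ends-right′ : ∀ {v} → v ∉ left ⌊ 2 * rounds /2⌋
    ends-right′ = subst (λ j → _ ∉ left j) (sym (⌊2n/2⌋≡n rounds)) ends-right

  -- Schedules of capacity |C| + 1 and |C|

  -- The cover C rides in the boat, except that S rests on the right bank in rounds 1, …, s
  -- and T on the left bank in rounds s+1, …, t-1; every vertex v ∉ C crosses in round τ v.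
  module Ferry (C S T : Subset n) (τ : Fin n → ℕ) (s t : ℕ)
    (cover : IsVertexCover G C) (S⊆C : S ⊆ C) (T⊆C : T ⊆ C)
    (S-independent : Independent G S) (T-independent : Independent G T)
    (S-neighbours-late : ∀ {v} → v ∈ NbhdOutside G C S → s ≤ τ v)
    (T-neighbours-early : ∀ {v} → v ∈ NbhdOutside G C T → τ v ≤ suc s)
    (crossings-in-time : ∀ {v} → v ∉ C → τ v ≤ t)
    where

    OnLeft : ℕ → Fin n → Set
    OnLeft j v = v ∉ C × j < τ v ⊎ v ∈ T × s < j × j < t

    OnRight : ℕ → Fin n → Set
    OnRight i v = v ∉ C × τ v < i ⊎ v ∈ S × 0 < i × i ≤ s

    on-left? : ∀ j → Decidable (OnLeft j)
    on-left? j v = ¬? (v ∈? C) ×-dec j <? τ v ⊎-dec v ∈? T ×-dec s <? j ×-dec j <? t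

    on-right? : ∀ i → Decidable (OnRight i)
    on-right? i v = ¬? (v ∈? C) ×-dec τ v <? i ⊎-dec v ∈? S ×-dec 0 <? i ×-dec i ≤? s

    left right : ℕ → Subset n
    left  j = tabulate λ v → ⌊ on-left? j v ⌋
    right i = tabulate λ v → ⌊ on-right? i v ⌋

    boat : ℕ → ℕ → Subset n
    boat j i = ∁ (left j ∪ right i)

    on-left : ∀ {j v} → v ∈ left j → OnLeft j v
    on-left {j} = ∈-tabulate⁻ (on-left? j)

    on-right : ∀ {i v} → v ∈ right i → OnRight i v
    on-right {i} = ∈-tabulate⁻ (on-right? i)

    disjoint : ∀ {j i} → j ≤ i → i ≤ suc j → ∀ {v} → v ∈ left j → v ∉ right i
    disjoint j≤i i≤1+j v∈L v∈R with on-left v∈L | on-right v∈R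
    ... | inj₁ (_ , j<τv)        | inj₁ (_ , τv<i)        = <⇒≱ j<τv (≤-pred (≤-trans τv<i i≤1+j))
    ... | inj₁ (v∉C , _)         | inj₂ (v∈S , _)         = v∉C (S⊆C v∈S)
    ... | inj₂ (v∈T , _)         | inj₁ (v∉C , _)         = v∉C (T⊆C v∈T)
    ... | inj₂ (_ , s<j , _)     | inj₂ (_ , _ , i≤s)     = <⇒≱ s<j (≤-trans j≤i i≤s)

    T-neighbour-stays : ∀ {j u v} → u ∈ T → s < j → v ∉ C → j < τ v → ¬ Adj G u v
    T-neighbour-stays u∈T s<j v∉C j<τv u~v =
      <⇒≱ j<τv (≤-trans (T-neighbours-early (∈NbhdOutside⁺ C v∉C u∈T u~v)) s<j)

    S-neighbour-waits : ∀ {i u v} → u ∈ S → i ≤ s → v ∉ C → τ v < i → ¬ Adj G u v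
    S-neighbour-waits u∈S i≤s v∉C τv<i u~v =
      <⇒≱ τv<i (≤-trans i≤s (S-neighbours-late (∈NbhdOutside⁺ C v∉C u∈S u~v)))

    left-independent : ∀ j → Independent G (left j)
    left-independent j u v u∈L v∈L u~v with on-left u∈L | on-left v∈L
    ... | inj₁ (u∉C , _)         | inj₁ (v∉C , _)         = [ u∉C , v∉C ] (cover u v u~v)
    ... | inj₂ (u∈T , _)         | inj₂ (v∈T , _)         = T-independent u v u∈T v∈T u~v
    ... | inj₂ (u∈T , s<j , _)   | inj₁ (v∉C , j<τv)      = T-neighbour-stays u∈T s<j v∉C j<τv u~v
    ... | inj₁ (u∉C , j<τu)      | inj₂ (v∈T , s<j , _)   =
      T-neighbour-stays v∈T s<j u∉C j<τu (SimpleGraph.sym G u~v)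

    right-independent : ∀ i → Independent G (right i)
    right-independent i u v u∈R v∈R u~v with on-right u∈R | on-right v∈R
    ... | inj₁ (u∉C , _)         | inj₁ (v∉C , _)         = [ u∉C , v∉C ] (cover u v u~v)
    ... | inj₂ (u∈S , _)         | inj₂ (v∈S , _)         = S-independent u v u∈S v∈S u~v
    ... | inj₂ (u∈S , _ , i≤s)   | inj₁ (v∉C , τv<i)      = S-neighbour-waits u∈S i≤s v∉C τv<i u~v
    ... | inj₁ (u∉C , τu<i)      | inj₂ (v∈S , _ , i≤s)   =
      S-neighbour-waits v∈S i≤s u∉C τu<i (SimpleGraph.sym G u~v)

    excess-crosses : ∀ {j i v} → j ≤ i → v ∈ boat j i ─ C → τ v ≡ j × τ v ≡ i
    excess-crosses {j} {i} {v} j≤i v∈ =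
      ≤-antisym τv≤j (≤-trans j≤i i≤τv) , ≤-antisym (≤-trans τv≤j j≤i) i≤τv
      where
      v∉C : v ∉ C
      v∉C = x∈p─q⇒x∉q v∈
      v∉L∪R : v ∉ left j ∪ right i
      v∉L∪R = x∈∁p⇒x∉p (p─q⊆p _ C v∈)
      τv≤j : τ v ≤ j
      τv≤j = ≮⇒≥ λ j<τv → v∉L∪R (x∈p∪q⁺ (inj₁ (∈-tabulate⁺ (on-left? j) (inj₁ (v∉C , j<τv)))))
      i≤τv : i ≤ τ v
      i≤τv = ≮⇒≥ λ τv<i → v∉L∪R (x∈p∪q⁺ (inj₂ (∈-tabulate⁺ (on-right? i) (inj₁ (v∉C , τv<i)))))

    S-rests : ∀ {j i} → 0 < i → i ≤ s → S ⊆ C ─ boat j i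
    S-rests {i = i} 0<i i≤s u∈S = x∈p∧x∉q⇒x∈p─q (S⊆C u∈S)
      (x∈p⇒x∉∁p (x∈p∪q⁺ (inj₂ (∈-tabulate⁺ (on-right? i) (inj₂ (u∈S , 0<i , i≤s))))))

    T-rests : ∀ {j i} → s < j → j < t → T ⊆ C ─ boat j i
    T-rests {j} s<j j<t u∈T = x∈p∧x∉q⇒x∈p─q (T⊆C u∈T)
      (x∈p⇒x∉∁p (x∈p∪q⁺ (inj₁ (∈-tabulate⁺ (on-left? j) (inj₂ (u∈T , s<j , j<t))))))

    ferry : ∀ {b} → (∀ {j i} → j ≤ i → i ≤ suc j → ∣ boat j i ∣ ≤ b) → Shuttle b
    ferry boat-fits = record
      { rounds            = t
      ; left              = left
      ; right             = right
      ; disjoint          = disjoint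
      ; left-independent  = λ {j} _ → left-independent j
      ; right-independent = λ {i} _ → right-independent i
      ; capacity          = λ j≤i i≤1+j _ → boat-fits j≤i i≤1+j
      ; starts-left       = λ v∈R → [ (λ { (_ , ()) }) , (λ { (_ , () , _) }) ] (on-right v∈R)
      ; ends-right        = λ v∈L → [ (λ (v∉C , t<τv) → <⇒≱ t<τv (crossings-in-time v∉C))
                                    , (λ (_ , _ , t<t) → <-irrefl refl t<t) ] (on-left v∈L)
      }

  feasible-suc∣C∣ : ∀ {C} → IsVertexCover G C → Feasible G (suc ∣ C ∣)
  feasible-suc∣C∣ {C} cover = shuttle⇒feasible (ferry boat-fits)
    where
    no-neighbours : ∀ {v} → v ∉ NbhdOutside G C ∅
    no-neighbours v∈N = ∉⊥ (proj₁ (proj₂ (proj₂ (∈NbhdOutside⁻ C v∈N))))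

    open Ferry C ∅ ∅ toℕ 0 n cover ⊥⊆ ⊥⊆ (λ _ _ u∈∅ _ _ → ∉⊥ u∈∅) (λ _ _ u∈∅ _ _ → ∉⊥ u∈∅)
      (⊥-elim ∘ no-neighbours) (⊥-elim ∘ no-neighbours) (λ {v} _ → <⇒≤ (toℕ<n v))

    boat-fits : ∀ {j i} → j ≤ i → i ≤ suc j → ∣ boat j i ∣ ≤ suc ∣ C ∣
    boat-fits {j} {i} j≤i _ = begin
      ∣ boat j i ∣               ≤⟨ ∣p∣≤∣q∣+∣p─q∣ (boat j i) C ⟩
      ∣ C ∣ + ∣ boat j i ─ C ∣  ≤⟨ +-monoʳ-≤ ∣ C ∣ (subsingleton⇒∣p∣≤1 _ same-round) ⟩
      ∣ C ∣ + 1                 ≡⟨ +-comm ∣ C ∣ 1 ⟩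
      suc ∣ C ∣                 ∎
      where
      open ≤-Reasoning
      same-round : ∀ {u v} → u ∈ boat j i ─ C → v ∈ boat j i ─ C → u ≡ v
      same-round u∈ v∈ =
        toℕ-injective (trans (proj₁ (excess-crosses j≤i u∈)) (sym (proj₁ (excess-crosses j≤i v∈))))

  module SparsePair {C S T : Subset n} (cover : IsVertexCover G C)
    (S-nonempty : Nonempty S) (T-nonempty : Nonempty T)
    (S-independent : Independent G S) (T-independent : Independent G T) (S⊆C : S ⊆ C) (T⊆C : T ⊆ C)
    (sparse : ∣ NbhdOutside G C S ∩ NbhdOutside G C T ∣ ≤ ∣ S ∣ + ∣ T ∣)
    where

    NS NT A : Subset n
    NS = NbhdOutside G C S
    NT = NbhdOutside G C T
    A  = NS ∩ NT

    F : Subset n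
    F = proj₁ (∣p∣≤s+t⇒split A ∣ S ∣ ∣ T ∣ sparse)

    ∣F∣≤∣S∣ : ∣ F ∣ ≤ ∣ S ∣
    ∣F∣≤∣S∣ = proj₁ (proj₂ (∣p∣≤s+t⇒split A ∣ S ∣ ∣ T ∣ sparse))

    ∣A─F∣≤∣T∣ : ∣ A ─ F ∣ ≤ ∣ T ∣
    ∣A─F∣≤∣T∣ = proj₂ (proj₂ (∣p∣≤s+t⇒split A ∣ S ∣ ∣ T ∣ sparse))

    data Role (v : Fin n) : Set where
      early  : v ∉ NS → Role v
      first  : v ∈ F → Role v
      second : v ∈ A ─ F → Role v
      late   : v ∉ NT → Role v

    role : ∀ v → Role v
    role v with v ∈? NS | v ∈? NT | v ∈? F
    ... | no  v∉NS | _        | _       = early v∉NS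
    ... | yes _    | no  v∉NT | _       = late v∉NT
    ... | yes _    | yes _    | yes v∈F = first v∈F
    ... | yes v∈NS | yes v∈NT | no  v∉F = second (x∈p∧x∉q⇒x∈p─q (x∈p∩q⁺ (v∈NS , v∈NT)) v∉F)

    round : ∀ {v} → Role v → ℕ
    round {v} (early _)  = suc (toℕ v)
    round     (first _)  = suc n
    round     (second _) = 2 + n
    round {v} (late _)   = 3 + n + toℕ v

    last : ℕ
    last = 3 + n + n

    n≤m⇒m≢toℕ : ∀ (v : Fin n) {m} → n ≤ m → m ≢ toℕ v
    n≤m⇒m≢toℕ v n≤m m≡v = <⇒≱ (toℕ<n v) (≤-trans n≤m (≤-reflexive m≡v))

    n<2+n+m : ∀ m → n < 2 + n + m
    n<2+n+m m = s≤s (m≤n⇒m≤1+n (m≤m+n n m))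

    S-neighbours-late : ∀ {v} (r : Role v) → v ∈ NS → suc n ≤ round r
    S-neighbours-late (early v∉NS) v∈NS = ⊥-elim (v∉NS v∈NS)
    S-neighbours-late (first _)    _    = ≤-refl
    S-neighbours-late (second _)   _    = n≤1+n _
    S-neighbours-late (late _)     _    = s≤s (<⇒≤ (n<2+n+m _))

    T-neighbours-early : ∀ {v} (r : Role v) → v ∈ NT → round r ≤ 2 + n
    T-neighbours-early {v} (early _) _ = s≤s (m≤n⇒m≤1+n (<⇒≤ (toℕ<n v)))
    T-neighbours-early (first _)     _ = n≤1+n _
    T-neighbours-early (second _)    _ = ≤-refl
    T-neighbours-early (late v∉NT) v∈NT = ⊥-elim (v∉NT v∈NT)

    round≤last : ∀ {v} (r : Role v) → round r ≤ last
    round≤last {v} (early _) = s≤s (≤-trans (<⇒≤ (toℕ<n v)) (<⇒≤ (n<2+n+m n)))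
    round≤last     (first _) = s≤s (<⇒≤ (n<2+n+m n))
    round≤last    (second _) = s≤s (n<2+n+m n)
    round≤last {v}  (late _) = +-monoʳ-≤ (3 + n) (<⇒≤ (toℕ<n v))

    early-round⁻¹ : ∀ {u v} (r : Role v) → round r ≡ suc (toℕ u) → v ≡ u
    early-round⁻¹     (early _)  eq = toℕ-injective (suc-injective eq)
    early-round⁻¹ {u} (first _)  eq = ⊥-elim (n≤m⇒m≢toℕ u ≤-refl (suc-injective eq))
    early-round⁻¹ {u} (second _) eq = ⊥-elim (n≤m⇒m≢toℕ u (n≤1+n n) (suc-injective eq))
    early-round⁻¹ {u} (late _)   eq = ⊥-elim (n≤m⇒m≢toℕ u (<⇒≤ (n<2+n+m _)) (suc-injective eq))

    first-round⁻¹ : ∀ {v} (r : Role v) → round r ≡ suc n → v ∈ F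
    first-round⁻¹ {v} (early _) eq = ⊥-elim (n≤m⇒m≢toℕ v ≤-refl (sym (suc-injective eq)))
    first-round⁻¹ (first v∈F)   _  = v∈F
    first-round⁻¹ (second _)    eq = ⊥-elim (1+n≢n (suc-injective eq))
    first-round⁻¹ (late _)      eq = ⊥-elim (<⇒≢ (n<2+n+m _) (sym (suc-injective eq)))

    second-round⁻¹ : ∀ {v} (r : Role v) → round r ≡ 2 + n → v ∈ A ─ F
    second-round⁻¹ {v} (early _) eq = ⊥-elim (n≤m⇒m≢toℕ v (n≤1+n n) (sym (suc-injective eq)))
    second-round⁻¹ (first _)     eq = ⊥-elim (1+n≢n (sym (suc-injective eq)))
    second-round⁻¹ (second v∈)   _  = v∈
    second-round⁻¹ (late _)      eq = ⊥-elim (m≢1+m+n n (sym (suc-injective (suc-injective eq))))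

    late-round⁻¹ : ∀ {u v} (r : Role v) → round r ≡ 3 + n + toℕ u → v ≡ u
    late-round⁻¹ {u} {v} (early _) eq = ⊥-elim (n≤m⇒m≢toℕ v (<⇒≤ (n<2+n+m (toℕ u))) (sym (suc-injective eq)))
    late-round⁻¹ (first _)  eq = ⊥-elim (<⇒≢ (n<2+n+m _) (suc-injective eq))
    late-round⁻¹ (second _) eq = ⊥-elim (m≢1+m+n n (suc-injective (suc-injective eq)))
    late-round⁻¹ (late _)   eq = toℕ-injective (+-cancelˡ-≡ (3 + n) _ _ eq)

    open Ferry C S T (λ v → round (role v)) (suc n) last cover S⊆C T⊆C S-independent T-independent
      (λ {v} → S-neighbours-late (role v)) (λ {v} → T-neighbours-early (role v))
      (λ {v} _ → round≤last (role v))

    resting-bound : ∀ {j i X} → ∣ boat j i ─ C ∣ ≤ ∣ X ∣ → X ⊆ C ─ boat j i →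
                    ∣ boat j i ─ C ∣ ≤ ∣ C ─ boat j i ∣
    resting-bound ∣E∣≤∣X∣ X⊆ = ≤-trans ∣E∣≤∣X∣ (p⊆q⇒∣p∣≤∣q∣ X⊆)

    excess≤resting : ∀ {j i u} → (∀ {v} → v ∈ boat j i ─ C → round (role v) ≡ i) →
                     (r : Role u) → round r ≡ j → round r ≡ i → ∣ boat j i ─ C ∣ ≤ ∣ C ─ boat j i ∣
    excess≤resting {u = u} crossing (early _) refl refl = resting-bound
      (≤-trans (subsingleton⇒∣p∣≤1 _ λ v∈ w∈ → trans (early-round⁻¹ (role _) (crossing v∈))
                                                     (sym (early-round⁻¹ (role _) (crossing w∈))))
               (x∈p⇒1≤∣p∣ (proj₂ S-nonempty)))
      (S-rests (s≤s z≤n) (s≤s (<⇒≤ (toℕ<n u))))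
    excess≤resting crossing (first _) refl refl = resting-bound
      (≤-trans (p⊆q⇒∣p∣≤∣q∣ (first-round⁻¹ (role _) ∘ crossing)) ∣F∣≤∣S∣)
      (S-rests (s≤s z≤n) ≤-refl)
    excess≤resting crossing (second _) refl refl = resting-bound
      (≤-trans (p⊆q⇒∣p∣≤∣q∣ (second-round⁻¹ (role _) ∘ crossing)) ∣A─F∣≤∣T∣)
      (T-rests ≤-refl (s≤s (s≤s (s≤s (m≤m+n n n)))))
    excess≤resting {u = u} crossing (late _) refl refl = resting-bound
      (≤-trans (subsingleton⇒∣p∣≤1 _ λ v∈ w∈ → trans (late-round⁻¹ (role _) (crossing v∈))
                                                    (sym (late-round⁻¹ (role _) (crossing w∈))))
               (x∈p⇒1≤∣p∣ (proj₂ T-nonempty)))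
      (T-rests (s≤s (n<2+n+m _)) (+-monoʳ-< (3 + n) (toℕ<n u)))

    boat-fits : ∀ {j i} → j ≤ i → i ≤ suc j → ∣ boat j i ∣ ≤ ∣ C ∣
    boat-fits {j} {i} j≤i _ = ∣p─q∣≤∣q─p∣⇒∣p∣≤∣q∣ (boat j i) C excess-fits
      where
      excess-fits : ∣ boat j i ─ C ∣ ≤ ∣ C ─ boat j i ∣
      excess-fits with nonempty? (boat j i ─ C)
      ... | no  none        = ≤-trans (≤-reflexive (empty⇒∣p∣≡0 none)) z≤n
      ... | yes (u , u∈) = excess≤resting (proj₂ ∘ excess-crosses j≤i) (role u)
                                          (proj₁ (excess-crosses j≤i u∈)) (proj₂ (excess-crosses j≤i u∈))

    feasible : Feasible G ∣ C ∣
    feasible = shuttle⇒feasible (ferry boat-fits)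

  -- No schedule of capacity at most |C| under the condition

  module Banks (tr : Triple G) where

    side : ∀ v → v ∈ L tr ⊎ v ∈ B tr ⊎ v ∈ R tr
    side v with x∈p∪q⁻ (L tr ∪ B tr) (R tr) (subst (v ∈_) (sym (cover tr)) ∈⊤)
    ... | inj₂ v∈R = inj₂ (inj₂ v∈R)
    ... | inj₁ v∈L∪B = [ inj₁ , inj₂ ∘ inj₁ ] (x∈p∪q⁻ (L tr) (B tr) v∈L∪B)

    L∌B : ∀ {v} → v ∈ L tr → v ∉ B tr
    L∌B v∈L v∈B = ∉⊥ (subst (_ ∈_) (disjLB tr) (x∈p∩q⁺ (v∈L , v∈B)))

    L∌R : ∀ {v} → v ∈ L tr → v ∉ R tr
    L∌R v∈L v∈R = ∉⊥ (subst (_ ∈_) (disjLR tr) (x∈p∩q⁺ (v∈L , v∈R)))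

    B∌R : ∀ {v} → v ∈ B tr → v ∉ R tr
    B∌R v∈B v∈R = ∉⊥ (subst (_ ∈_) (disjBR tr) (x∈p∩q⁺ (v∈B , v∈R)))

    L∪B≡Full⇒R-empty : L tr ∪ B tr ≡ Full → ∀ {v} → v ∉ R tr
    L∪B≡Full⇒R-empty L∪B≡Full {v} v∈R =
      [ (λ v∈L → L∌R v∈L v∈R) , (λ v∈B → B∌R v∈B v∈R) ]
        (x∈p∪q⁻ (L tr) (B tr) (subst (v ∈_) (sym L∪B≡Full) ∈⊤))

    B∪R≡Full⇒L-empty : B tr ∪ R tr ≡ Full → ∀ {v} → v ∉ L tr
    B∪R≡Full⇒L-empty B∪R≡Full {v} v∈L =
      [ L∌B v∈L , L∌R v∈L ] (x∈p∪q⁻ (B tr) (R tr) (subst (v ∈_) (sym B∪R≡Full) ∈⊤))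

  module Necessity {C : Subset n} (expansion : Expansion C) where

    N : Subset n → Subset n
    N = NbhdOutside G C

    record Stable : Set where
      field
        members     : Subset n
        nonempty    : Nonempty members
        independent : Independent G members
        ⊆C          : members ⊆ C
    open Stable

    singleton : ∀ {c} → c ∈ C → Stable
    singleton {c} c∈C = record
      { members     = ⁅ c ⁆
      ; nonempty    = c , x∈⁅x⁆ c
      ; independent = λ u v u∈ v∈ → subst₂ (λ x y → ¬ Adj G x y)
                                      (sym (x∈⁅y⁆⇒x≡y c u∈)) (sym (x∈⁅y⁆⇒x≡y c v∈)) (irrefl G)
      ; ⊆C          = λ x∈ → subst (_∈ C) (sym (x∈⁅y⁆⇒x≡y c x∈)) c∈C
      }

    overflow : ∀ (S T : Stable) {D} → (∀ {w} → w ∈ N (members S) → w ∈ N (members T) → w ∈ D) →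
               ∣ D ∣ ≤ ∣ members S ∣ + ∣ members T ∣ → ⊥
    overflow S T common⊆D ∣D∣≤ = <⇒≱
      (expansion (members S) (members T) (nonempty S) (nonempty T)
                 (independent S) (independent T) (⊆C S) (⊆C T))
      (≤-trans (p⊆q⇒∣p∣≤∣q∣ (uncurry common⊆D ∘ x∈p∩q⁻ _ _)) ∣D∣≤)

    stable-part : ∀ {P} → Independent G P → Nonempty (C ∩ P) → Stable
    stable-part {P} P-independent C∩P≠∅ = record
      { members     = C ∩ P
      ; nonempty    = C∩P≠∅
      ; independent = λ u v u∈ v∈ → P-independent u v (proj₂ (x∈p∩q⁻ C P u∈)) (proj₂ (x∈p∩q⁻ C P v∈))
      ; ⊆C          = proj₁ ∘ x∈p∩q⁻ C P
      }

    N[C∩P]∌P : ∀ {P w} → Independent G P → w ∈ N (C ∩ P) → w ∉ P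
    N[C∩P]∌P {P} P-independent w∈N w∈P with ∈NbhdOutside⁻ C w∈N
    ... | _ , v , v∈C∩P , v~w = P-independent v _ (proj₂ (x∈p∩q⁻ C P v∈C∩P)) w∈P v~w

    record Admissible (tr : Triple G) : Set where
      field
        left-independent  : Independent G (L tr)
        right-independent : Independent G (R tr)
        fits              : ∣ B tr ∣ ≤ ∣ C ∣

    module Crossing {tr : Triple G} (admissible : Admissible tr) where
      open Banks tr
      open Admissible admissible

      X Y D : Subset n
      X = C ∩ L tr
      Y = C ∩ R tr
      D = B tr ─ C

      ∣D∣≤∣X∣+∣Y∣ : ∣ D ∣ ≤ ∣ X ∣ + ∣ Y ∣
      ∣D∣≤∣X∣+∣Y∣ = begin
        ∣ B tr ─ C ∣  ≤⟨ ∣p∣≤∣q∣⇒∣p─q∣≤∣q─p∣ (B tr) C fits ⟩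
        ∣ C ─ B tr ∣  ≤⟨ p⊆q⇒∣p∣≤∣q∣ C─B⊆X∪Y ⟩
        ∣ X ∪ Y ∣     ≤⟨ ∣p∪q∣≤∣p∣+∣q∣ X Y ⟩
        ∣ X ∣ + ∣ Y ∣ ∎
        where
        open ≤-Reasoning
        C─B⊆X∪Y : C ─ B tr ⊆ X ∪ Y
        C─B⊆X∪Y {v} v∈ with side v
        ... | inj₁ v∈L        = x∈p∪q⁺ (inj₁ (x∈p∩q⁺ (p─q⊆p C _ v∈ , v∈L)))
        ... | inj₂ (inj₁ v∈B) = ⊥-elim (x∈p─q⇒x∉q v∈ v∈B)
        ... | inj₂ (inj₂ v∈R) = x∈p∪q⁺ (inj₂ (x∈p∩q⁺ (p─q⊆p C _ v∈ , v∈R)))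

      left-or-D : ∀ {w} → w ∉ C → w ∉ R tr → w ∈ L tr ⊎ w ∈ D
      left-or-D {w} w∉C w∉R with side w
      ... | inj₁ w∈L        = inj₁ w∈L
      ... | inj₂ (inj₁ w∈B) = inj₂ (x∈p∧x∉q⇒x∈p─q w∈B w∉C)
      ... | inj₂ (inj₂ w∈R) = ⊥-elim (w∉R w∈R)

      stranded : ∀ {w} → w ∉ C → w ∉ L tr → w ∉ R tr → w ∈ D
      stranded w∉C w∉L w∉R = [ ⊥-elim ∘ w∉L , (λ w∈D → w∈D) ] (left-or-D w∉C w∉R)

      X-stable : Nonempty X → Stable
      X-stable = stable-part left-independent

      Y-stable : Nonempty Y → Stable
      Y-stable = stable-part right-independent

      N[X]∌L : ∀ {w} → w ∈ N X → w ∉ L tr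
      N[X]∌L = N[C∩P]∌P left-independent

      N[Y]∌R : ∀ {w} → w ∈ N Y → w ∉ R tr
      N[Y]∌R = N[C∩P]∌P right-independent

      cover-on-one-bank : Nonempty X → Nonempty Y → ⊥
      cover-on-one-bank X≠∅ Y≠∅ = overflow (Y-stable Y≠∅) (X-stable X≠∅)
        (λ w∈NY w∈NX → stranded (proj₁ (∈NbhdOutside⁻ C w∈NX)) (N[X]∌L w∈NX) (N[Y]∌R w∈NY))
        (≤-trans ∣D∣≤∣X∣+∣Y∣ (≤-reflexive (+-comm ∣ X ∣ ∣ Y ∣)))

    record Sheltered (left : Subset n) : Set where
      field
        anchor    : Stable
        shelter   : Subset n
        small     : ∣ shelter ∣ ≤ ∣ members anchor ∣
        sheltered : ∀ {w} → w ∈ N (members anchor) → w ∈ left ⊎ w ∈ shelter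

    Invariant : Triple G → Set
    Invariant tr = ¬ Nonempty (C ∩ L tr) × Sheltered (L tr)

    initial : ∀ {tr} → Admissible tr → (∀ {v} → v ∉ R tr) → Nonempty C → Invariant tr
    initial {tr} admissible R-empty (c , c∈C) = X-empty , record
      { anchor    = singleton c∈C
      ; shelter   = D
      ; small     = ≤-trans ∣D∣≤∣X∣+∣Y∣ (≤-trans (≤-reflexive ∣X∣+∣Y∣≡0) z≤n)
      ; sheltered = λ w∈N → left-or-D (proj₁ (∈NbhdOutside⁻ C w∈N)) R-empty
      }
      where
      open Crossing admissible

      ∣Y∣≡0 : ∣ Y ∣ ≡ 0
      ∣Y∣≡0 = empty⇒∣p∣≡0 λ (_ , v∈Y) → R-empty (proj₂ (x∈p∩q⁻ C _ v∈Y))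

      X-empty : ¬ Nonempty X
      X-empty X≠∅ = overflow (X-stable X≠∅) (X-stable X≠∅)
        (λ w∈N _ → stranded (proj₁ (∈NbhdOutside⁻ C w∈N)) (N[X]∌L w∈N) R-empty)
        (≤-trans ∣D∣≤∣X∣+∣Y∣ (+-monoʳ-≤ ∣ X ∣ (≤-trans (≤-reflexive ∣Y∣≡0) z≤n)))

      ∣X∣+∣Y∣≡0 : ∣ X ∣ + ∣ Y ∣ ≡ 0
      ∣X∣+∣Y∣≡0 = cong₂ _+_ (empty⇒∣p∣≡0 X-empty) ∣Y∣≡0

    right-step : ∀ {tr tr′ : Triple G} → L tr′ ≡ L tr → Invariant tr → Invariant tr′
    right-step L′≡L = subst (λ left → ¬ Nonempty (C ∩ left) × Sheltered left) (sym L′≡L)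

    fresh : ∀ {tr} (admissible : Admissible tr) → ¬ Nonempty (C ∩ L tr) → Nonempty (C ∩ R tr) →
            Sheltered (L tr)
    fresh {tr} admissible X-empty Y≠∅ = record
      { anchor    = Y-stable Y≠∅
      ; shelter   = D
      ; small     = ≤-trans ∣D∣≤∣X∣+∣Y∣ (≤-reflexive (cong (_+ ∣ Y ∣) (empty⇒∣p∣≡0 X-empty)))
      ; sheltered = λ w∈N → left-or-D (proj₁ (∈NbhdOutside⁻ C w∈N)) (N[Y]∌R w∈N)
      }
      where open Crossing admissible

    left-step-X-empty : ∀ {tr tr′ : Triple G} → Admissible tr′ → R tr′ ≡ R tr → Sheltered (L tr) →
                        ¬ Nonempty (C ∩ L tr′)
    left-step-X-empty {tr} {tr′} admissible′ R′≡R old X′≠∅ with nonempty? (C ∩ R tr′)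
    ... | yes Y′≠∅    = cover-on-one-bank X′≠∅ Y′≠∅
      where open Crossing admissible′
    ... | no  Y′-empty = overflow anchor (X-stable X′≠∅) {shelter ∪ D} common bound
      where
      open Crossing admissible′
      open Sheltered old
      common : ∀ {w} → w ∈ N (members anchor) → w ∈ N X → w ∈ shelter ∪ D
      common {w} w∈N w∈NX with sheltered w∈N
      ... | inj₂ w∈shelter = x∈p∪q⁺ (inj₁ w∈shelter)
      ... | inj₁ w∈L       = x∈p∪q⁺ (inj₂ (stranded (proj₁ (∈NbhdOutside⁻ C w∈NX)) (N[X]∌L w∈NX)
                               (Banks.L∌R tr w∈L ∘ subst (w ∈_) R′≡R)))
      ∣X∣+∣Y∣≡∣X∣ : ∣ X ∣ + ∣ Y ∣ ≡ ∣ X ∣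
      ∣X∣+∣Y∣≡∣X∣ = trans (cong (∣ X ∣ +_) (empty⇒∣p∣≡0 Y′-empty)) (+-identityʳ ∣ X ∣)
      bound : ∣ shelter ∪ D ∣ ≤ ∣ members anchor ∣ + ∣ X ∣
      bound = begin
        ∣ shelter ∪ D ∣                      ≤⟨ ∣p∪q∣≤∣p∣+∣q∣ shelter D ⟩
        ∣ shelter ∣ + ∣ D ∣                  ≤⟨ +-mono-≤ small ∣D∣≤∣X∣+∣Y∣ ⟩
        ∣ members anchor ∣ + (∣ X ∣ + ∣ Y ∣) ≡⟨ cong (∣ members anchor ∣ +_) ∣X∣+∣Y∣≡∣X∣ ⟩
        ∣ members anchor ∣ + ∣ X ∣           ∎
        where open ≤-Reasoning

    kept : ∀ {tr tr′ : Triple G} → Admissible tr′ → B tr′ ∪ L tr′ ≡ B tr ∪ L tr →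
           ¬ Nonempty (C ∩ L tr′) → ¬ Nonempty (C ∩ R tr′) → Sheltered (L tr) → Sheltered (L tr′)
    kept {tr} {tr′} admissible′ B′∪L′≡B∪L X′-empty Y′-empty old = record
      { anchor    = anchor
      ; shelter   = shelter
      ; small     = small
      ; sheltered = sheltered′
      }
      where
      open Crossing admissible′
      open Sheltered old
      D-empty : ∀ {w} → w ∉ D
      D-empty w∈D = 1+n≰n (≤-trans (x∈p⇒1≤∣p∣ w∈D) (≤-trans ∣D∣≤∣X∣+∣Y∣
                      (≤-reflexive (cong₂ _+_ (empty⇒∣p∣≡0 X′-empty) (empty⇒∣p∣≡0 Y′-empty)))))
      sheltered′ : ∀ {w} → w ∈ N (members anchor) → w ∈ L tr′ ⊎ w ∈ shelter
      sheltered′ {w} w∈N with sheltered w∈N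
      ... | inj₂ w∈shelter = inj₂ w∈shelter
      ... | inj₁ w∈L with x∈p∪q⁻ (B tr′) (L tr′) (subst (w ∈_) (sym B′∪L′≡B∪L) (x∈p∪q⁺ (inj₂ w∈L)))
      ...   | inj₂ w∈L′ = inj₁ w∈L′
      ...   | inj₁ w∈B′ = ⊥-elim (D-empty (x∈p∧x∉q⇒x∈p─q w∈B′ (proj₁ (∈NbhdOutside⁻ C w∈N))))

    left-step : ∀ {tr tr′ : Triple G} → Admissible tr′ → R tr′ ≡ R tr → B tr′ ∪ L tr′ ≡ B tr ∪ L tr →
                Invariant tr → Invariant tr′
    left-step {tr} {tr′} admissible′ R′≡R B′∪L′≡B∪L (_ , old) =
      X′-empty , next (nonempty? (C ∩ R tr′))
      where
      X′-empty : ¬ Nonempty (C ∩ L tr′)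
      X′-empty = left-step-X-empty {tr} admissible′ R′≡R old
      next : Dec (Nonempty (C ∩ R tr′)) → Sheltered (L tr′)
      next (yes Y′≠∅)    = fresh admissible′ X′-empty Y′≠∅
      next (no  Y′-empty) = kept {tr} admissible′ B′∪L′≡B∪L X′-empty Y′-empty old

    final : ∀ {tr} → (∀ {v} → v ∉ L tr) → ¬ Invariant tr
    final L-empty (_ , witness) =
      overflow anchor anchor {shelter} (λ w∈N _ → [ ⊥-elim ∘ L-empty , (λ w∈ → w∈) ] (sheltered w∈N))
        (≤-trans small (m≤m+n _ _))
      where open Sheltered witness

    infeasible : Nonempty C → ∀ {b} → b ≤ ∣ C ∣ → ¬ Feasible G b
    infeasible C≠∅ b≤∣C∣ schedule =
      final {t (2 * m)} (Banks.B∪R≡Full⇒L-empty (t (2 * m)) finish) (invariant (2 * m) ≤-refl)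
      where
      open FeasibleSchedule schedule

      admissible : ∀ k → k ≤ 2 * m → Admissible (t k)
      admissible k k≤2m = record
        { left-independent  = indepL k (s≤s k≤2m)
        ; right-independent = indepR k (s≤s k≤2m)
        ; fits              = ≤-trans (cap k (s≤s k≤2m)) b≤∣C∣
        }

      step : ∀ k → suc k ≤ 2 * m → Invariant (t k) → Invariant (t (suc k))
      step k k<2m with parity k
      ... | even j = right-step {t (2 * j)} {t (suc (2 * j))} (evenL j (s≤s k<2m))
      ... | odd  j = left-step {t (suc (2 * j))} (admissible (suc (suc (2 * j))) k<2m)
                       (oddR j (s≤s k<2m)) (oddBL j (s≤s k<2m))

      invariant : ∀ k → k ≤ 2 * m → Invariant (t k)
      invariant zero    _    = initial (admissible 0 z≤n) (Banks.L∪B≡Full⇒R-empty (t 0) start) C≠∅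
      invariant (suc k) k<2m = step k k<2m (invariant k (<⇒≤ k<2m))

theorem2p6 : {n : ℕ} (G : SimpleGraph n) (C : Subset n) →
    IsMinimumVertexCover G C →
    ClassTwo G ⇔
      ((S T : Subset n) → Nonempty S → Nonempty T → Independent G S → Independent G T →
        S ⊆ C → T ⊆ C →
        ∣ S ∣ + ∣ T ∣ < ∣ NbhdOutside G C S ∩ NbhdOutside G C T ∣)
theorem2p6 G C (cover , minimum) = mk⇔ class-two⇒expansion expansion⇒class-two
  where
  class-two⇒expansion : ClassTwo G → Expansion G C
  class-two⇒expansion (_ , (C′ , (cover′ , _) , refl) , _ , (_ , _ , least) , refl)
                      S T S≠∅ T≠∅ S-independent T-independent S⊆C T⊆C
    with ∣ S ∣ + ∣ T ∣ <? ∣ NbhdOutside G C S ∩ NbhdOutside G C T ∣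
  ... | yes expands = expands
  ... | no  sparse  = contradiction (minimum C′ cover′) (<⇒≱ (least ∣ C ∣ 1≤∣C∣ feasible))
    where
    1≤∣C∣ : 1 ≤ ∣ C ∣
    1≤∣C∣ = x∈p⇒1≤∣p∣ (S⊆C (proj₂ S≠∅))
    feasible : Feasible G ∣ C ∣
    feasible = SparsePair.feasible G cover S≠∅ T≠∅ S-independent T-independent S⊆C T⊆C (≮⇒≥ sparse)

  expansion⇒class-two : Expansion G C → ClassTwo G
  expansion⇒class-two expansion =
    ∣ C ∣ , (C , (cover , minimum) , refl) ,
    suc ∣ C ∣ , (s≤s z≤n , feasible-suc∣C∣ G cover , least) , refl
    where
    least : ∀ b → 1 ≤ b → Feasible G b → suc ∣ C ∣ ≤ b
    least b 1≤b feasible = ≰⇒> λ b≤∣C∣ →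
      Necessity.infeasible G expansion (1≤∣p∣⇒nonempty (≤-trans 1≤b b≤∣C∣)) b≤∣C∣ feasible
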